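{- For every integer $k>3$, there is no strongly regular configuration with parameters $(v_k;\lambda,\mu)$ where $$v=\Bigl(\binom{k}{2}+1\Bigr)^2,\qquad \lambda=\binom{k}{2}-1,\qquad \mu=2.$$
   Context: A symmetric $(v_k)$ configuration is a finite incidence structure of $v$ points and $v$ lines such that every line has exactly $k$ points, every point lies on exactly $k$ lines, and two distinct points lie on at most one common line. Its point graph has the points as vertices, two distinct points adjacent iff they lie on a common line. A strongly regular configuration with parameters $(v_k;\lambda,\mu)$ is a symmetric $(v_k)$ configuration whose point graph is a strongly regular graph $SRG(v,k(k-1),\lambda,\mu)$ ($v$ vertices, regular of degree $k(k-1)$, adjacent vertices have $\lambda$ common neighbours, distinct non-adjacent vertices have $\mu$ common neighbours). -}

module Defs where

open import Data.Nat using (ℕ; zero; suc; _+_)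
open import Data.Bool using (Bool; true; false; _∧_; not)
open import Data.Fin using (Fin; zero; suc; _≟_)
open import Data.Product using (_×_)
open import Relation.Nullary.Decidable using (⌊_⌋)
open import Relation.Binary.PropositionalEquality using (_≡_)

count : {n : ℕ} → (Fin n → Bool) → ℕ
count {zero}  f = 0
count {suc n} f = if′ (f zero) + count (λ i → f (suc i))
  where
  if′ : Bool → ℕ
  if′ true  = 1
  if′ false = 0

anyFin : {n : ℕ} → (Fin n → Bool) → Bool
anyFin {zero}  f = false
anyFin {suc n} f = Data.Bool._∨_ (f zero) (anyFin (λ i → f (suc i)))

-- An incidence structure with v points and v lines, both indexed by Fin v;
-- inc p L = true  iff point p lies on line L.
Incidence : ℕ → Set
Incidence v = Fin v → Fin v → Bool

distinct : {v : ℕ} → Fin v → Fin v → Bool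
distinct p q = not ⌊ p ≟ q ⌋

record IsSymmetricConfiguration (v k : ℕ) (inc : Incidence v) : Set where
  field
    lineSize   : (L : Fin v) → count (λ p → inc p L) ≡ k
    pointDeg   : (p : Fin v) → count (λ L → inc p L) ≡ k
    atMostOne  : (p q L M : Fin v) → distinct p q ≡ true →
                 inc p L ≡ true → inc q L ≡ true →
                 inc p M ≡ true → inc q M ≡ true → L ≡ M

adjacent : {v : ℕ} → Incidence v → Fin v → Fin v → Bool
adjacent inc p q = distinct p q ∧ anyFin (λ L → inc p L ∧ inc q L)

record IsSRG (v d λ' μ : ℕ) (adj : Fin v → Fin v → Bool) : Set where
  field
    irreflexive : (p : Fin v) → adj p p ≡ false
    symmetric   : (p q : Fin v) → adj p q ≡ adj q p
    regular     : (p : Fin v) → count (λ q → adj p q) ≡ d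
    lambdaCond  : (p q : Fin v) → adj p q ≡ true →
                  count (λ r → adj p r ∧ adj q r) ≡ λ'
    muCond      : (p q : Fin v) → distinct p q ≡ true → adj p q ≡ false →
                  count (λ r → adj p r ∧ adj q r) ≡ μ

record IsStronglyRegularConfiguration (v k λ' μ : ℕ) (inc : Incidence v) : Set where
  field
    configuration : IsSymmetricConfiguration v k inc
    pointGraphSRG : IsSRG v (k Data.Nat.* (k Data.Nat.∸ 1)) λ' μ (adjacent inc)

-- With n = k(k-1)/2 the point graph is an SRG(v, 2n, n - 1, 2), the parameters of
-- the (n+1) × (n+1) rook's graph.  Counting common neighbours shows that for
-- adjacent p and q the neighbours of p not adjacent to q form, apart from q, a
-- clique with no edge to the common neighbours of p and q.  Take a common neighbour
-- a of p and q off the line pq and let M be the line qa: every point of M is then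
-- collinear with p, so the lines joining p to the k points of M are k distinct
-- lines through p.  For a neighbour b ≠ q of p not adjacent to q, however, the line
-- pb misses M, so p would lie on k + 1 lines.

module Submission where

open import Defs
open import Data.Nat using (ℕ; zero; suc; _+_; _*_; _∸_; _≤_; _<_; _>_; z≤n; s≤s; s≤s⁻¹)
open import Data.Nat.Combinatorics using (_C_; nCk+nC[k+1]≡[n+1]C[k+1]; nC1≡n)
open import Relation.Nullary using (¬_; yes; no)

open import Data.Bool using (Bool; true; false; _∧_; not)
open import Data.Bool.Properties using (∧-conicalˡ; ∧-conicalʳ; ∧-comm; not-injective; ¬-not)
open import Data.Empty using (⊥; ⊥-elim)
open import Data.Fin using (Fin; zero; suc; _≟_)
import Data.Fin.Properties as Fin
open import Data.Vec.Functional using (tail)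
open import Data.Nat.Properties hiding (_≟_)
open import Data.Nat.Tactic.RingSolver using (solve-∀)
open import Data.Product using (∃; _×_; _,_; proj₁; proj₂)
open import Function using (_∘_)
open import Relation.Binary.PropositionalEquality
open import Relation.Nullary.Decidable using (⌊_⌋; isYes≗does; dec-true)

private
  variable
    m v : ℕ
    a b b₁ b₂ p q x y z L M N : Fin v
    S T : Fin v → Bool

infix 4 _∈_ _∉_ _⊆_
infixl 7 _∩_ _∖_

-- Membership is a record, and ∩, ∖ and ⁅_⁆ are opaque, so that the point and the set
-- of a membership proof can be recovered by unification.
record _∈_ {v : ℕ} (x : Fin v) (S : Fin v → Bool) : Set where
  constructor member
  field holds : S x ≡ true

open _∈_

_∉_ : Fin v → (Fin v → Bool) → Set
x ∉ S = ¬ x ∈ S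

_⊆_ : (Fin v → Bool) → (Fin v → Bool) → Set
S ⊆ T = ∀ {x} → x ∈ S → x ∈ T

Disjoint : (Fin v → Bool) → (Fin v → Bool) → Set
Disjoint S T = ∀ {x} → x ∈ S → x ∈ T → ⊥

opaque
  _∩_ _∖_ : (Fin v → Bool) → (Fin v → Bool) → Fin v → Bool
  (S ∩ T) x = S x ∧ T x
  (S ∖ T) x = S x ∧ not (T x)

  ⁅_⁆ : Fin v → Fin v → Bool
  ⁅ y ⁆ x = ⌊ x ≟ y ⌋

false⇒∉ : S x ≡ false → x ∉ S
false⇒∉ Sx≡false (member Sx≡true) with () ← trans (sym Sx≡true) Sx≡false

∉⇒false : x ∉ S → S x ≡ false
∉⇒false x∉S = ¬-not (λ Sx → x∉S (member Sx))

¬∉⇒∈ : ¬ x ∉ S → x ∈ S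
¬∉⇒∈ {x = x} {S} ¬x∉S with S x in Sx
... | true  = member Sx
... | false = ⊥-elim (¬x∉S (false⇒∉ Sx))

∉∈⇒≢ : x ∉ S → y ∈ S → x ≢ y
∉∈⇒≢ x∉S y∈S refl = x∉S y∈S

≢⇒distinct : x ≢ y → distinct x y ≡ true
≢⇒distinct {x = x} {y} x≢y with x ≟ y
... | yes x≡y = ⊥-elim (x≢y x≡y)
... | no _    = refl

opaque
  unfolding _∩_

  ∩⁺ : x ∈ S → x ∈ T → x ∈ S ∩ T
  ∩⁺ (member Sx) (member Tx) = member (cong₂ _∧_ Sx Tx)

  ∩⁻ : x ∈ S ∩ T → x ∈ S × x ∈ T
  ∩⁻ {x = x} {S} {T} (member SxTx) =
    member (∧-conicalˡ (S x) (T x) SxTx) , member (∧-conicalʳ (S x) (T x) SxTx)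

  ∖⁺ : x ∈ S → x ∉ T → x ∈ S ∖ T
  ∖⁺ {x = x} {T = T} (member Sx) x∉T with T x in Tx
  ... | true  = ⊥-elim (x∉T (member Tx))
  ... | false = member (cong₂ _∧_ Sx (cong not Tx))

  ∖⁻ : x ∈ S ∖ T → x ∈ S × x ∉ T
  ∖⁻ {x = x} {S} {T} (member Sx¬Tx) =
    member (∧-conicalˡ (S x) (not (T x)) Sx¬Tx) ,
    false⇒∉ (not-injective (∧-conicalʳ (S x) (not (T x)) Sx¬Tx))

  y∈⁅y⁆ : y ∈ ⁅ y ⁆
  y∈⁅y⁆ {y = y} = member (trans (isYes≗does (y ≟ y)) (dec-true (y ≟ y) refl))

  ∈⁅⁆⇒≡ : x ∈ ⁅ y ⁆ → x ≡ y
  ∈⁅⁆⇒≡ {x = x} {y} (member x≟y) with x ≟ y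
  ... | yes x≡y = x≡y

≢⇒∉⁅⁆ : x ≢ y → x ∉ ⁅ y ⁆
≢⇒∉⁅⁆ x≢y x∈⁅y⁆ = x≢y (∈⁅⁆⇒≡ x∈⁅y⁆)

∉⁅⁆⇒≢ : x ∉ ⁅ y ⁆ → x ≢ y
∉⁅⁆⇒≢ x∉⁅y⁆ refl = x∉⁅y⁆ y∈⁅y⁆

∈-tail⁺ : suc x ∈ S → x ∈ tail S
∈-tail⁺ (member Sx) = member Sx

∈-tail⁻ : x ∈ tail S → suc x ∈ S
∈-tail⁻ (member Sx) = member Sx

anyFin-intro : x ∈ S → anyFin S ≡ true
anyFin-intro {x = zero}  {S} (member Sx) rewrite Sx = refl
anyFin-intro {x = suc x} {S} (member Sx) with S zero
... | true  = refl
... | false = anyFin-intro {S = tail S} (member Sx)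

anyFin-witness : ∀ {v} {S : Fin v → Bool} → anyFin S ≡ true → ∃ λ x → x ∈ S
anyFin-witness {suc v} {S} any with S zero in S0
... | true  = zero , member S0
... | false = let x , member Sx = anyFin-witness {S = tail S} any in suc x , member Sx

count-witness : ∀ {v} {S : Fin v → Bool} → 0 < count S → ∃ λ x → x ∈ S
count-witness {suc v} {S} 0<count with S zero in S0
... | true  = zero , member S0
... | false = let x , member Sx = count-witness {S = tail S} 0<count in suc x , member Sx

count-pos : x ∈ S → 0 < count S
count-pos {x = zero}  {S} (member Sx) rewrite Sx = s≤s z≤n
count-pos {x = suc x} {S} (member Sx) with S zero
... | true  = s≤s z≤n
... | false = count-pos {S = tail S} (member Sx)

count-mono : ∀ {v} {S T : Fin v → Bool} → S ⊆ T → count S ≤ count T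
count-mono {zero}          S⊆T = z≤n
count-mono {suc v} {S} {T} S⊆T
  with S zero in S0 | T zero in T0 | count-mono {S = tail S} {tail T} (λ x∈ → ∈-tail⁺ (S⊆T (∈-tail⁻ x∈)))
... | true  | true  | ih = s≤s ih
... | true  | false | _  = ⊥-elim (false⇒∉ {S = T} T0 (S⊆T (member S0)))
... | false | true  | ih = m≤n⇒m≤1+n ih
... | false | false | ih = ih

count-≗ : ∀ {v} {S T : Fin v → Bool} → (∀ x → S x ≡ T x) → count S ≡ count T
count-≗ {zero}          S≗T = refl
count-≗ {suc v} {S} {T} S≗T with S zero | T zero | S≗T zero
... | true  | .true  | refl = cong suc (count-≗ (S≗T ∘ suc))
... | false | .false | refl = count-≗ (S≗T ∘ suc)

opaque
  unfolding _∩_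

  count-partition : ∀ (S T : Fin v → Bool) → count S ≡ count (S ∩ T) + count (S ∖ T)
  count-partition {zero}  S T = refl
  count-partition {suc v} S T with S zero | T zero
  ... | true  | true  = cong suc (count-partition (tail S) (tail T))
  ... | true  | false = trans (cong suc (count-partition (tail S) (tail T)))
                              (sym (+-suc _ _))
  ... | false | _     = count-partition (tail S) (tail T)

  count-∩-∖-comm : ∀ (S T U : Fin v → Bool) → count (S ∩ T ∖ U) ≡ count (S ∖ U ∩ T)
  count-∩-∖-comm S T U = count-≗ S∩T∖U≗S∖U∩T
    where
    S∩T∖U≗S∖U∩T : ∀ x → (S x ∧ T x) ∧ not (U x) ≡ (S x ∧ not (U x)) ∧ T x
    S∩T∖U≗S∖U∩T x with S x
    ... | true  = ∧-comm (T x) (not (U x))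
    ... | false = refl

count-∩-< : x ∈ S ∖ T → count (S ∩ T) < count S
count-∩-< {S = S} {T} x∈S∖T = begin-strict
  count (S ∩ T)                  <⟨ m<m+n _ (count-pos x∈S∖T) ⟩
  count (S ∩ T) + count (S ∖ T)  ≡⟨ count-partition S T ⟨
  count S                        ∎
  where open ≤-Reasoning

count-∖-< : x ∈ S ∩ T → count (S ∖ T) < count S
count-∖-< {S = S} {T} x∈S∩T = begin-strict
  count (S ∖ T)                  <⟨ m<n+m _ (count-pos x∈S∩T) ⟩
  count (S ∩ T) + count (S ∖ T)  ≡⟨ count-partition S T ⟨
  count S                        ∎
  where open ≤-Reasoning

-- The map f is only required on S, since the lines joining a point to the points
-- of another line are obtained from proofs of collinearity.
count-injection : ∀ {v w} {S : Fin v → Bool} {T : Fin w → Bool} →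
                  (f : ∀ x → x ∈ S → Fin w) → (∀ x x∈S → f x x∈S ∈ T) →
                  (∀ x y x∈S y∈S → f x x∈S ≡ f y y∈S → x ≡ y) → count S ≤ count T
count-injection {zero} f f∈T f-inj = z≤n
count-injection {suc v} {w} {S} {T} f f∈T f-inj with S zero in S0
... | false = count-injection (λ x x∈S → f (suc x) (∈-tail⁻ x∈S)) (λ x x∈S → f∈T (suc x) (∈-tail⁻ x∈S))
                (λ x y x∈S y∈S eq → Fin.suc-injective (f-inj _ _ (∈-tail⁻ x∈S) (∈-tail⁻ y∈S) eq))
... | true  = ≤-trans (s≤s rest) (count-∖-< (∩⁺ (f∈T zero (member S0)) y∈⁅y⁆))
  where
  f₀ : Fin w
  f₀ = f zero (member S0)
  rest : count (tail S) ≤ count (T ∖ ⁅ f₀ ⁆)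
  rest = count-injection (λ x x∈S → f (suc x) (∈-tail⁻ x∈S))
    (λ x x∈S → ∖⁺ (f∈T (suc x) (∈-tail⁻ x∈S))
                  (≢⇒∉⁅⁆ λ eq → Fin.0≢1+n (f-inj zero (suc x) (member S0) (∈-tail⁻ x∈S) (sym eq))))
    (λ x y x∈S y∈S eq → Fin.suc-injective (f-inj _ _ (∈-tail⁻ x∈S) (∈-tail⁻ y∈S) eq))

count-true : count {m} (λ _ → true) ≡ m
count-true {zero}  = refl
count-true {suc m} = cong suc count-true

count-≤-cover : (ys : Fin m → Fin v) → (∀ {x} → x ∈ S → ∃ λ i → ys i ≡ x) → count S ≤ m
count-≤-cover {m} {S = S} ys cover = begin
  count S                  ≤⟨ count-injection index (λ _ _ → member refl) index-injective ⟩
  count {m} (λ _ → true)   ≡⟨ count-true ⟩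
  m                        ∎
  where
  open ≤-Reasoning
  index : ∀ x → x ∈ S → Fin m
  index _ x∈S = proj₁ (cover x∈S)
  index-injective : ∀ x x′ x∈S x′∈S → index x x∈S ≡ index x′ x′∈S → x ≡ x′
  index-injective x x′ x∈S x′∈S eq =
    trans (sym (proj₂ (cover x∈S))) (trans (cong ys eq) (proj₂ (cover x′∈S)))

three-≤-count : x ∈ S → y ∈ S → z ∈ S → x ≢ y → x ≢ z → y ≢ z → 3 ≤ count S
three-≤-count {x = x} {S} {y} {z} x∈S y∈S z∈S x≢y x≢z y≢z = begin
  3                                       ≤⟨ m≤m+n 3 _ ⟩
  3 + count (S ∖ ⁅ x ⁆ ∖ ⁅ y ⁆ ∖ ⁅ z ⁆)   ≤⟨ +-monoʳ-≤ 2 (count-∖-< (∩⁺ z∈S∖⁅x⁆∖⁅y⁆ y∈⁅y⁆)) ⟩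
  2 + count (S ∖ ⁅ x ⁆ ∖ ⁅ y ⁆)           ≤⟨ +-monoʳ-≤ 1 (count-∖-< (∩⁺ y∈S∖⁅x⁆ y∈⁅y⁆)) ⟩
  1 + count (S ∖ ⁅ x ⁆)                   ≤⟨ count-∖-< (∩⁺ x∈S y∈⁅y⁆) ⟩
  count S                                 ∎
  where
  open ≤-Reasoning
  y∈S∖⁅x⁆ : y ∈ S ∖ ⁅ x ⁆
  y∈S∖⁅x⁆ = ∖⁺ y∈S (≢⇒∉⁅⁆ (x≢y ∘ sym))
  z∈S∖⁅x⁆∖⁅y⁆ : z ∈ S ∖ ⁅ x ⁆ ∖ ⁅ y ⁆
  z∈S∖⁅x⁆∖⁅y⁆ = ∖⁺ (∖⁺ z∈S (≢⇒∉⁅⁆ (x≢z ∘ sym))) (≢⇒∉⁅⁆ (y≢z ∘ sym))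

other-element : 2 ≤ count S → ∀ y → ∃ λ x → x ∈ S × x ≢ y
other-element {S = S} 2≤count y =
  let x , x∈S∖⁅y⁆ = count-witness (s≤s⁻¹ (begin
        2                                      ≤⟨ 2≤count ⟩
        count S                                ≡⟨ count-partition S ⁅ y ⁆ ⟩
        count (S ∩ ⁅ y ⁆) + count (S ∖ ⁅ y ⁆)  ≤⟨ +-monoˡ-≤ _ (count-≤-cover (λ (_ : Fin 1) → y) at-y) ⟩
        1 + count (S ∖ ⁅ y ⁆)                  ∎))
      x∈S , x∉⁅y⁆ = ∖⁻ x∈S∖⁅y⁆
  in x , x∈S , ∉⁅⁆⇒≢ x∉⁅y⁆
  where
  open ≤-Reasoning
  at-y : ∀ {x} → x ∈ S ∩ ⁅ y ⁆ → ∃ λ (i : Fin 1) → y ≡ x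
  at-y x∈S∩⁅y⁆ = zero , sym (∈⁅⁆⇒≡ (proj₂ (∩⁻ x∈S∩⁅y⁆)))

module LatticeParameters {v n : ℕ} (adj : Fin v → Fin v → Bool)
  (srg : IsSRG v (n + n) (n ∸ 1) 2 adj) (4≤n : 4 ≤ n) where

  open IsSRG srg

  private
    1≤n : 1 ≤ n
    1≤n = ≤-trans (s≤s z≤n) 4≤n

  ∈-sym : y ∈ adj x → x ∈ adj y
  ∈-sym {y} {x} (member adj[x,y]) = member (trans (symmetric y x) adj[x,y])

  ∉-sym : y ∉ adj x → x ∉ adj y
  ∉-sym y∉adj[x] x∈adj[y] = y∉adj[x] (∈-sym x∈adj[y])

  x∉adj[x] : x ∉ adj x
  x∉adj[x] {x} = false⇒∉ (irreflexive x)

  adjacent⇒≢ : y ∈ adj x → x ≢ y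
  adjacent⇒≢ y∈adj[x] refl = x∉adj[x] y∈adj[x]

  opaque
    unfolding _∩_

    count-common-adjacent : y ∈ adj x → suc (count (adj x ∩ adj y)) ≡ n
    count-common-adjacent {y} {x} (member adj[x,y]) =
      trans (cong suc (lambdaCond x y adj[x,y])) (sym (+-∸-assoc 1 1≤n))

    count-common-nonadjacent : x ≢ y → y ∉ adj x → count (adj x ∩ adj y) ≡ 2
    count-common-nonadjacent {x} {y} x≢y y∉adj[x] =
      muCond x y (≢⇒distinct x≢y) (∉⇒false y∉adj[x])

  has-neighbour : ∀ x → ∃ λ y → y ∈ adj x
  has-neighbour x = count-witness (subst (0 <_) (sym (regular x)) (≤-trans 1≤n (m≤m+n n n)))

  few-common-neighbours-in : x ≢ y → y ∉ adj x → z ∈ adj x ∩ adj y → z ∉ S →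
                             count (S ∩ adj x ∩ adj y) ≤ 1
  few-common-neighbours-in {x} {y} {z} {S} x≢y y∉adj[x] z∈adj[x]∩adj[y] z∉S = s≤s⁻¹ (begin-strict
    count (S ∩ adj x ∩ adj y)  ≤⟨ count-mono reorder ⟩
    count (adj x ∩ adj y ∩ S)  <⟨ count-∩-< (∖⁺ z∈adj[x]∩adj[y] z∉S) ⟩
    count (adj x ∩ adj y)      ≡⟨ count-common-nonadjacent x≢y y∉adj[x] ⟩
    2                          ∎)
    where
    open ≤-Reasoning
    reorder : S ∩ adj x ∩ adj y ⊆ adj x ∩ adj y ∩ S
    reorder r∈ = let r∈S∩adj[x] , r∈adj[y] = ∩⁻ r∈ ; r∈S , r∈adj[x] = ∩⁻ r∈S∩adj[x]
                 in ∩⁺ (∩⁺ r∈adj[x] r∈adj[y]) r∈S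

  module _ {p q : Fin v} (q∈adj[p] : q ∈ adj p) where

    count-∖ : count (adj p ∖ adj q) ≡ suc n
    count-∖ = +-cancelˡ-≡ c _ _ (begin
      c + count (adj p ∖ adj q)  ≡⟨ count-partition (adj p) (adj q) ⟨
      count (adj p)              ≡⟨ regular p ⟩
      n + n                      ≡⟨ cong (_+ n) (count-common-adjacent q∈adj[p]) ⟨
      suc c + n                  ≡⟨ +-suc c n ⟨
      c + suc n                  ∎)
      where
      open ≡-Reasoning
      c : ℕ
      c = count (adj p ∩ adj q)

    another-non-neighbour : ∃ λ b → b ∈ adj p ∖ adj q × b ≢ q
    another-non-neighbour = other-element (subst (2 ≤_) (sym count-∖) (s≤s 1≤n)) q

    module _ {b : Fin v} (b∈adj[p]∖adj[q] : b ∈ adj p ∖ adj q) (b≢q : b ≢ q) where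

      λ-split : suc (count (adj p ∩ adj b ∩ adj q) + count (adj p ∖ adj q ∩ adj b)) ≡ n
      λ-split = begin
        suc (count (adj p ∩ adj b ∩ adj q) + count (adj p ∖ adj q ∩ adj b))
          ≡⟨ cong (λ c → suc (count (adj p ∩ adj b ∩ adj q) + c)) (count-∩-∖-comm (adj p) (adj b) (adj q)) ⟨
        suc (count (adj p ∩ adj b ∩ adj q) + count (adj p ∩ adj b ∖ adj q))
          ≡⟨ cong suc (count-partition (adj p ∩ adj b) (adj q)) ⟨
        suc (count (adj p ∩ adj b))
          ≡⟨ count-common-adjacent (proj₁ (∖⁻ b∈adj[p]∖adj[q])) ⟩
        n ∎
        where open ≡-Reasoning

      shared-with-q : count (adj p ∩ adj b ∩ adj q) ≤ 1
      shared-with-q = few-common-neighbours-in b≢q (∉-sym (proj₂ (∖⁻ b∈adj[p]∖adj[q])))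
        (∩⁺ (∈-sym (proj₁ (∖⁻ b∈adj[p]∖adj[q]))) (∈-sym q∈adj[p])) x∉adj[x]

      ∖-split : count (adj p ∖ adj q ∩ adj b) + count (adj p ∖ adj q ∖ adj b) ≡ suc n
      ∖-split = trans (sym (count-partition (adj p ∖ adj q) (adj b))) count-∖

      few-non-neighbours : count (adj p ∖ adj q ∖ adj b) ≤ 3
      few-non-neighbours = +-cancelˡ-≤ Y _ _ (begin
        Y + count (adj p ∖ adj q ∖ adj b)  ≡⟨ ∖-split ⟩
        suc n                              ≡⟨ cong suc λ-split ⟨
        2 + (X + Y)                        ≤⟨ +-monoʳ-≤ 2 (+-monoˡ-≤ Y shared-with-q) ⟩
        3 + Y                              ≡⟨ +-comm 3 Y ⟩
        Y + 3                              ∎)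
        where
        open ≤-Reasoning
        X Y : ℕ
        X = count (adj p ∩ adj b ∩ adj q)
        Y = count (adj p ∖ adj q ∩ adj b)

    q∈adj[p]∖adj[q] : q ∈ adj p ∖ adj q
    q∈adj[p]∖adj[q] = ∖⁺ q∈adj[p] x∉adj[x]

    -- If b₁ and b₂ were not adjacent, then b₁, b₂ and q would be all the (at most
    -- three) non-neighbours of b₂ in B = adj p ∖ adj q, so the neighbours of b₁ in B
    -- would be common neighbours of b₁ and b₂ other than p: at most one, so |B| ≤ 4.
    ∖-clique : b₁ ∈ adj p ∖ adj q → b₁ ≢ q → b₂ ∈ adj p ∖ adj q → b₂ ≢ q → b₁ ≢ b₂ →
               b₂ ∈ adj b₁
    ∖-clique {b₁} {b₂} b₁∈B b₁≢q b₂∈B b₂≢q b₁≢b₂ = ¬∉⇒∈ λ b₂∉adj[b₁] → <⇒≱ 4≤n (n≤3 b₂∉adj[b₁])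
      where
      B : Fin v → Bool
      B = adj p ∖ adj q
      W U Z₁ I : ℕ
      W = count (B ∩ adj b₁ ∩ adj b₂)
      U = count (B ∩ adj b₁ ∖ adj b₂)
      Z₁ = count (B ∖ adj b₁)
      I = count (B ∖ adj b₂ ∖ adj b₁)

      n≤3 : b₂ ∉ adj b₁ → n ≤ 3
      n≤3 b₂∉adj[b₁] = s≤s⁻¹ (begin
        suc n            ≡⟨ count-∖ ⟨
        count B          ≡⟨ count-partition B (adj b₁) ⟩
        count (B ∩ adj b₁) + Z₁   ≡⟨ cong (_+ Z₁) (count-partition (B ∩ adj b₁) (adj b₂)) ⟩
        W + U + Z₁       ≤⟨ +-mono-≤ (+-mono-≤ W≤1 U≤0) (few-non-neighbours b₁∈B b₁≢q) ⟩
        4                ∎)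
        where
        open ≤-Reasoning
        b₁∉adj[b₂] : b₁ ∉ adj b₂
        b₁∉adj[b₂] = ∉-sym b₂∉adj[b₁]
        p∈adj[b₁]∩adj[b₂] : p ∈ adj b₁ ∩ adj b₂
        p∈adj[b₁]∩adj[b₂] = ∩⁺ (∈-sym (proj₁ (∖⁻ b₁∈B))) (∈-sym (proj₁ (∖⁻ b₂∈B)))
        W≤1 : W ≤ 1
        W≤1 = few-common-neighbours-in b₁≢b₂ b₂∉adj[b₁] p∈adj[b₁]∩adj[b₂]
                (λ p∈B → x∉adj[x] (proj₁ (∖⁻ p∈B)))
        3≤I : 3 ≤ I
        3≤I = three-≤-count (∖⁺ (∖⁺ b₁∈B b₁∉adj[b₂]) x∉adj[x]) (∖⁺ (∖⁺ b₂∈B x∉adj[x]) b₂∉adj[b₁])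
                (∖⁺ (∖⁺ q∈adj[p]∖adj[q] (∉-sym (proj₂ (∖⁻ b₂∈B)))) (∉-sym (proj₂ (∖⁻ b₁∈B))))
                b₁≢b₂ b₁≢q b₂≢q
        U≤0 : U ≤ 0
        U≤0 = +-cancelʳ-≤ 3 U 0 (begin
          U + 3                          ≤⟨ +-monoʳ-≤ U 3≤I ⟩
          U + I                          ≡⟨ cong (_+ I) (count-∩-∖-comm B (adj b₁) (adj b₂)) ⟩
          count (B ∖ adj b₂ ∩ adj b₁) + I ≡⟨ count-partition (B ∖ adj b₂) (adj b₁) ⟨
          count (B ∖ adj b₂)             ≤⟨ few-non-neighbours b₂∈B b₂≢q ⟩
          3                              ∎)

    -- |B ∖ adj b| exceeds |adj p ∩ adj b ∩ adj q| by two, but B ∖ adj b ⊆ {b, q}.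
    ∖-common-nonadjacent : b ∈ adj p ∖ adj q → b ≢ q → a ∈ adj p ∩ adj q → a ∉ adj b
    ∖-common-nonadjacent {b} {a} b∈B b≢q a∈adj[p]∩adj[q] a∈adj[b] = 1+n≰n (+-cancelˡ-≤ Y 3 2 (begin
      Y + 3        ≡⟨ +-comm Y 3 ⟩
      2 + (1 + Y)  ≤⟨ +-monoʳ-≤ 2 (+-monoˡ-≤ Y 1≤X) ⟩
      2 + (X + Y)  ≡⟨ cong suc (λ-split b∈B b≢q) ⟩
      suc n        ≡⟨ ∖-split b∈B b≢q ⟨
      Y + Z        ≤⟨ +-monoʳ-≤ Y Z≤2 ⟩
      Y + 2        ∎))
      where
      open ≤-Reasoning
      B : Fin v → Bool
      B = adj p ∖ adj q
      X Y Z : ℕ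
      X = count (adj p ∩ adj b ∩ adj q)
      Y = count (B ∩ adj b)
      Z = count (B ∖ adj b)
      1≤X : 1 ≤ X
      1≤X = let a∈adj[p] , a∈adj[q] = ∩⁻ a∈adj[p]∩adj[q] in count-pos (∩⁺ (∩⁺ a∈adj[p] a∈adj[b]) a∈adj[q])
      b-or-q : Fin 2 → Fin v
      b-or-q zero    = b
      b-or-q (suc _) = q
      cover : ∀ {r} → r ∈ B ∖ adj b → ∃ λ i → b-or-q i ≡ r
      cover {r} r∈B∖adj[b] with r ≟ b | r ≟ q
      ... | yes r≡b | _       = zero , sym r≡b
      ... | no _    | yes r≡q = suc zero , sym r≡q
      ... | no r≢b  | no r≢q  = let r∈B , r∉adj[b] = ∖⁻ r∈B∖adj[b]
                                in ⊥-elim (r∉adj[b] (∖-clique b∈B b≢q r∈B r≢q (r≢b ∘ sym)))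
      Z≤2 : Z ≤ 2
      Z≤2 = count-≤-cover b-or-q cover

module SymmetricConfiguration {v k : ℕ} {inc : Incidence v}
  (conf : IsSymmetricConfiguration v k inc) where

  open IsSymmetricConfiguration conf

  points : Fin v → Fin v → Bool
  points L x = inc x L

  lines : Fin v → Fin v → Bool
  lines p = inc p

  points⇒lines : p ∈ points L → L ∈ lines p
  points⇒lines (member p∈L) = member p∈L

  adj : Fin v → Fin v → Bool
  adj = adjacent inc

  collinear⇒adjacent : x ≢ y → x ∈ points L → y ∈ points L → y ∈ adj x
  collinear⇒adjacent {L = L} x≢y (member x∈L) (member y∈L) =
    member (cong₂ _∧_ (≢⇒distinct x≢y) (anyFin-intro {x = L} (member (cong₂ _∧_ x∈L y∈L))))

  adjacent⇒collinear : y ∈ adj x → ∃ λ L → x ∈ points L × y ∈ points L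
  adjacent⇒collinear {y} {x} (member y∈adj[x]) =
    let L , member xy∈L = anyFin-witness (∧-conicalʳ (distinct x y) _ y∈adj[x])
    in L , member (∧-conicalˡ (inc x L) (inc y L) xy∈L) , member (∧-conicalʳ (inc x L) (inc y L) xy∈L)

  line-unique : x ≢ y → x ∈ points L → y ∈ points L → x ∈ points M → y ∈ points M → L ≡ M
  line-unique {x} {y} {L} {M} x≢y (member x∈L) (member y∈L) (member x∈M) (member y∈M) =
    atMostOne x y L M (≢⇒distinct x≢y) x∈L y∈L x∈M y∈M

  every-line-through-meets : p ∉ points M → points M ⊆ adj p → p ∈ points N →
                             ¬ Disjoint (points N) (points M)
  every-line-through-meets {p} {M} {N} p∉M M⊆adj[p] p∈N N∩M≡∅ = 1+n≰n (begin
    suc k                            ≡⟨ cong suc (lineSize M) ⟨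
    suc (count (points M))           ≤⟨ s≤s (count-injection join join∈ join-injective) ⟩
    suc (count (lines p ∖ ⁅ N ⁆))    ≤⟨ count-∖-< (∩⁺ (points⇒lines p∈N) y∈⁅y⁆) ⟩
    count (lines p)                  ≡⟨ pointDeg p ⟩
    k                                ∎)
    where
    open ≤-Reasoning
    joining : ∀ x → x ∈ points M → ∃ λ L → p ∈ points L × x ∈ points L
    joining x x∈M = adjacent⇒collinear (M⊆adj[p] x∈M)
    join : ∀ x → x ∈ points M → Fin v
    join x x∈M = proj₁ (joining x x∈M)
    join∈ : ∀ x x∈M → join x x∈M ∈ lines p ∖ ⁅ N ⁆
    join∈ x x∈M = let L , p∈L , x∈L = joining x x∈M
                  in ∖⁺ (points⇒lines p∈L) λ L∈⁅N⁆ → N∩M≡∅ (subst (λ L → x ∈ points L) (∈⁅⁆⇒≡ L∈⁅N⁆) x∈L) x∈M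
    join-injective : ∀ x y x∈M y∈M → join x x∈M ≡ join y y∈M → x ≡ y
    join-injective x y x∈M y∈M eq with x ≟ y
    ... | yes x≡y = x≡y
    ... | no x≢y  = let L , p∈L , x∈L = joining x x∈M ; _ , _ , y∈L′ = joining y y∈M
                        y∈L = subst (λ L → y ∈ points L) (sym eq) y∈L′
                    in ⊥-elim (p∉M (subst (λ L → p ∈ points L) (line-unique x≢y x∈L y∈L x∈M y∈M) p∈L))

module _ {v n k : ℕ} {inc : Incidence v} (conf : IsSymmetricConfiguration v k inc)
  (srg : IsSRG v (n + n) (n ∸ 1) 2 (adjacent inc)) (4≤n : 4 ≤ n) (k≤n : k ≤ n) where

  open IsSymmetricConfiguration conf using (lineSize)
  open SymmetricConfiguration conf
  open LatticeParameters adj srg 4≤n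

  common-neighbour-off-line : q ∈ adj p → p ∈ points L → q ∈ points L →
                              ∃ λ a → a ∈ adj p ∩ adj q ∖ points L
  common-neighbour-off-line {q} {p} {L} q∈adj[p] p∈L q∈L = count-witness 0<d
    where
    open ≤-Reasoning
    c d : ℕ
    c = count (adj p ∩ adj q ∩ points L)
    d = count (adj p ∩ adj q ∖ points L)
    reorder : adj p ∩ adj q ∩ points L ⊆ points L ∩ adj p ∩ adj q
    reorder r∈ = let r∈adj[p]∩adj[q] , r∈L = ∩⁻ r∈ ; r∈adj[p] , r∈adj[q] = ∩⁻ r∈adj[p]∩adj[q]
                 in ∩⁺ (∩⁺ r∈L r∈adj[p]) r∈adj[q]
    2+c≤1+c+d : 2 + c ≤ 1 + (c + d)
    2+c≤1+c+d = begin
      2 + c                                       ≤⟨ +-monoʳ-≤ 2 (count-mono reorder) ⟩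
      2 + count (points L ∩ adj p ∩ adj q)        ≤⟨ s≤s (count-∩-< (∖⁺ (∩⁺ q∈L q∈adj[p]) x∉adj[x])) ⟩
      1 + count (points L ∩ adj p)                ≤⟨ count-∩-< (∖⁺ p∈L x∉adj[x]) ⟩
      count (points L)                            ≡⟨ lineSize L ⟩
      k                                           ≤⟨ k≤n ⟩
      n                                           ≡⟨ count-common-adjacent q∈adj[p] ⟨
      1 + count (adj p ∩ adj q)                   ≡⟨ cong suc (count-partition (adj p ∩ adj q) (points L)) ⟩
      1 + (c + d)                                 ∎
    0<d : 0 < d
    0<d = +-cancelˡ-≤ c 1 d (subst (_≤ c + d) (+-comm 1 c) (s≤s⁻¹ 2+c≤1+c+d))

  line-of-common-neighbours : q ∈ adj p → a ∈ adj p ∩ adj q → q ∈ points M → a ∈ points M →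
                              p ∉ points M → points M ⊆ adj p
  line-of-common-neighbours {q} {p} q∈adj[p] a∈adj[p]∩adj[q] q∈M a∈M p∉M {x} x∈M = ¬∉⇒∈ λ x∉adj[p] →
    let a∈adj[p] , a∈adj[q] = ∩⁻ a∈adj[p]∩adj[q]
        x∈adj[q] : x ∈ adj q
        x∈adj[q] = collinear⇒adjacent (∉∈⇒≢ x∉adj[p] q∈adj[p] ∘ sym) q∈M x∈M
        x≢p : x ≢ p
        x≢p = λ { refl → p∉M x∈M }
    in ∖-common-nonadjacent (∈-sym q∈adj[p]) (∖⁺ x∈adj[q] x∉adj[p]) x≢p (∩⁺ a∈adj[q] a∈adj[p])
         (collinear⇒adjacent (∉∈⇒≢ x∉adj[p] a∈adj[p]) x∈M a∈M)

  line-missing : q ∈ adj p → b ∈ adj p ∖ adj q → b ≢ q → b ∈ points N → q ∈ points M →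
                 points M ⊆ adj p → Disjoint (points N) (points M)
  line-missing {q} {p} {b} q∈adj[p] b∈B b≢q b∈N q∈M M⊆adj[p] {y} y∈N y∈M =
    ∖-common-nonadjacent q∈adj[p] b∈B b≢q (∩⁺ (M⊆adj[p] y∈M) y∈adj[q]) (collinear⇒adjacent b≢y b∈N y∈N)
    where
    b∉adj[q] : b ∉ adj q
    b∉adj[q] = proj₂ (∖⁻ b∈B)
    q≢y : q ≢ y
    q≢y refl = b∉adj[q] (∈-sym (collinear⇒adjacent b≢q b∈N y∈N))
    b≢y : b ≢ y
    b≢y refl = b∉adj[q] (collinear⇒adjacent (b≢q ∘ sym) q∈M y∈M)
    y∈adj[q] : y ∈ adj q
    y∈adj[q] = collinear⇒adjacent q≢y q∈M y∈M

  no-point : ¬ Fin v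
  no-point p =
    let q , q∈adj[p] = has-neighbour p
        L₀ , p∈L₀ , q∈L₀ = adjacent⇒collinear q∈adj[p]
        a , a∈adj[p]∩adj[q]∖L₀ = common-neighbour-off-line q∈adj[p] p∈L₀ q∈L₀
        a∈adj[p]∩adj[q] , a∉L₀ = ∖⁻ a∈adj[p]∩adj[q]∖L₀
        M , q∈M , a∈M = adjacent⇒collinear (proj₂ (∩⁻ a∈adj[p]∩adj[q]))
        p∉M : p ∉ points M
        p∉M = λ p∈M → a∉L₀ (subst (λ L → a ∈ points L)
                (sym (line-unique (adjacent⇒≢ q∈adj[p]) p∈L₀ q∈L₀ p∈M q∈M)) a∈M)
        b , b∈adj[p]∖adj[q] , b≢q = another-non-neighbour q∈adj[p]
        N , p∈N , b∈N = adjacent⇒collinear (proj₁ (∖⁻ b∈adj[p]∖adj[q]))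
        M⊆adj[p] : points M ⊆ adj p
        M⊆adj[p] = line-of-common-neighbours q∈adj[p] a∈adj[p]∩adj[q] q∈M a∈M p∉M
    in every-line-through-meets p∉M M⊆adj[p] p∈N
         (line-missing q∈adj[p] b∈adj[p]∖adj[q] b≢q b∈N q∈M M⊆adj[p])

[1+n]C2≡n+nC2 : ∀ n → suc n C 2 ≡ n + n C 2
[1+n]C2≡n+nC2 n = trans (sym (nCk+nC[k+1]≡[n+1]C[k+1] n 1)) (cong (_+ n C 2) (nC1≡n n))

nC2+nC2≡n*[n∸1] : ∀ n → n C 2 + n C 2 ≡ n * (n ∸ 1)
nC2+nC2≡n*[n∸1] zero          = refl
nC2+nC2≡n*[n∸1] (suc zero)    = refl
nC2+nC2≡n*[n∸1] (suc (suc n)) = begin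
  suc (suc n) C 2 + suc (suc n) C 2        ≡⟨ cong₂ _+_ ([1+n]C2≡n+nC2 (suc n)) ([1+n]C2≡n+nC2 (suc n)) ⟩
  (suc n + suc n C 2) + (suc n + suc n C 2) ≡⟨ interchange (suc n) (suc n C 2) ⟩
  (suc n + suc n) + (suc n C 2 + suc n C 2) ≡⟨ cong (suc n + suc n +_) (nC2+nC2≡n*[n∸1] (suc n)) ⟩
  (suc n + suc n) + suc n * n               ≡⟨ step n ⟩
  suc (suc n) * suc n                       ∎
  where
  open ≡-Reasoning
  interchange : ∀ a c → (a + c) + (a + c) ≡ (a + a) + (c + c)
  interchange = solve-∀
  step : ∀ n → (suc n + suc n) + suc n * n ≡ suc (suc n) * suc n
  step = solve-∀

n≤nC2 : ∀ {n} → 3 ≤ n → n ≤ n C 2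
n≤nC2 {n} 3≤n = *-cancelˡ-≤ 2 (begin
  2 * n            ≡⟨ *-comm 2 n ⟩
  n * 2            ≤⟨ *-monoʳ-≤ n (∸-monoˡ-≤ 1 3≤n) ⟩
  n * (n ∸ 1)      ≡⟨ nC2+nC2≡n*[n∸1] n ⟨
  n C 2 + n C 2    ≡⟨ cong (n C 2 +_) (+-identityʳ (n C 2)) ⟨
  2 * (n C 2)      ∎)
  where open ≤-Reasoning

corollary21 : (k : ℕ) → k > 3 →
    (inc : Incidence (((k C 2) + 1) * ((k C 2) + 1))) →
    ¬ IsStronglyRegularConfiguration (((k C 2) + 1) * ((k C 2) + 1)) k ((k C 2) ∸ 1) 2 inc
corollary21 k 3<k inc isSRC =
  no-point configuration srg (≤-trans 3<k k≤n) k≤n point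
  where
  open IsStronglyRegularConfiguration isSRC
  n : ℕ
  n = k C 2
  k≤n : k ≤ n
  k≤n = n≤nC2 (<⇒≤ 3<k)
  point : Fin ((n + 1) * (n + 1))
  point = subst Fin (cong₂ _*_ (+-comm 1 n) (+-comm 1 n)) zero
  srg : IsSRG ((n + 1) * (n + 1)) (n + n) (n ∸ 1) 2 (adjacent inc)
  srg = subst (λ d → IsSRG ((n + 1) * (n + 1)) d (n ∸ 1) 2 (adjacent inc))
              (sym (nC2+nC2≡n*[n∸1] k)) pointGraphSRG
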